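{- Let $n=\prod_{i=1}^{k}p_i^{\alpha_i}$ where $p_1,\dots,p_k$ are distinct primes and $\alpha_i\ge1$. If $k\ge 3$, then the power graph $\mathfrak{g}(\mathbb{Z}_n)$ has no simplicial vertex.
   Context: The power graph $\mathfrak{g}(G)$ of a group $G$ has vertex set $G$, distinct $x,y$ adjacent iff $\langle x\rangle\le\langle y\rangle$ or $\langle y\rangle\le\langle x\rangle$. A vertex is simplicial if its neighbours are pairwise adjacent. $\mathbb{Z}_n$ is the additive group of integers mod $n$. -}

module Defs where

open import Data.Nat using (ℕ; zero; suc; _+_; _*_; _^_; _%_; _≤_; NonZero)
open import Data.Fin using (Fin; toℕ)
open import Data.Product using (Σ; _×_; ∃-syntax)
open import Data.Sum using (_⊎_)
open import Relation.Nullary using (¬_)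
open import Relation.Binary.PropositionalEquality using (_≡_)

-- The cyclic group ℤ_n (n ≥ 1) is represented by Fin n, with x ↦ toℕ x.
-- z lies in the cyclic subgroup ⟨y⟩ of ℤ_n iff z = m·y (mod n) for some m ∈ ℕ.
_∈⟨_⟩ : ∀ {n} .{{_ : NonZero n}} → Fin n → Fin n → Set
_∈⟨_⟩ {n} z y = ∃[ m ] ((m * toℕ y) % n ≡ toℕ z)

_⊆⟨⟩_ : ∀ {n} .{{_ : NonZero n}} → Fin n → Fin n → Set
_⊆⟨⟩_ {n} x y = ∀ (z : Fin n) → z ∈⟨ x ⟩ → z ∈⟨ y ⟩

Adj : ∀ {n} .{{_ : NonZero n}} → Fin n → Fin n → Set
Adj x y = ¬ (x ≡ y) × ((x ⊆⟨⟩ y) ⊎ (y ⊆⟨⟩ x))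

Simplicial : ∀ {n} .{{_ : NonZero n}} → Fin n → Set
Simplicial {n} v = ∀ (x y : Fin n) → Adj v x → Adj v y → ¬ (x ≡ y) → Adj x y

module Submission where

open import Defs
open import Data.Empty using (⊥-elim)
open import Data.Nat using (ℕ; suc; _*_; _^_; _%_; _≤_; NonZero; s≤s)
open import Data.Nat.DivMod using (_mod_; m%n<n; m%n%n≡m%n; %-distribˡ-*; m<n⇒m%n≡m)
open import Data.Nat.Divisibility
  using (_∣_; _∣?_; divides; ∣-refl; ∣-trans; m∣m*n; ∣n⇒∣m*n; %-presˡ-∣; ∣n∣m%n⇒∣m)
open import Data.Nat.ListAction using (product)
open import Data.Nat.ListAction.Properties using (∈⇒∣product)
open import Data.Nat.Primality using (Prime; prime⇒irreducible; ¬prime[1]; euclidsLemma)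
open import Data.Nat.Properties using (*-assoc; *-identityˡ)
open import Data.Fin using (Fin; toℕ)
open import Data.Fin.Properties using (toℕ<n; toℕ-fromℕ<)
open import Data.Product using (_×_; proj₁; proj₂; _,_)
open import Data.Sum using (inj₁; inj₂)
open import Data.List using (List; length; map; []; _∷_)
open import Data.List.Membership.Propositional using (_∈_)
open import Data.List.Membership.Propositional.Properties using (∈-map⁺)
open import Data.List.Relation.Unary.All using (All; _∷_)
open import Data.List.Relation.Unary.Any using (here; there)
open import Data.List.Relation.Unary.AllPairs using (_∷_)
open import Data.List.Relation.Unary.Unique.Propositional using (Unique)
open import Relation.Nullary using (¬_; yes; no)
open import Relation.Binary.PropositionalEquality
  using (_≡_; _≢_; ≢-sym; refl; sym; trans; cong; subst; module ≡-Reasoning)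

-- Every divisor of n that divides y divides all of ⟨y⟩ ⊆ ℤ_n.  Take distinct primes
-- p, q, r dividing n; two of them, say p and q, either both divide v or both do not.
-- In the first case p and q are neighbours of v above it, in the second p·v and q·v are
-- neighbours below it.  Either way p divides the first neighbour but not the second and
-- q the other way round, so the two neighbours are not adjacent.

prime∣prime⇒≡ : ∀ {p q} → Prime p → Prime q → q ∣ p → q ≡ p
prime∣prime⇒≡ pp qp q∣p with prime⇒irreducible pp q∣p
... | inj₁ refl = ⊥-elim (¬prime[1] qp)
... | inj₂ q≡p  = q≡p

prime∤prime : ∀ {p q} → Prime p → Prime q → p ≢ q → ¬ p ∣ q
prime∤prime pp qp p≢q p∣q = p≢q (prime∣prime⇒≡ qp pp p∣q)

prime∤* : ∀ {p m k} → Prime p → ¬ p ∣ m → ¬ p ∣ k → ¬ p ∣ m * k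
prime∤* {m = m} {k} pp p∤m p∤k p∣mk with euclidsLemma m k pp p∣mk
... | inj₁ p∣m = p∤m p∣m
... | inj₂ p∣k = p∤k p∣k

m∣m^n : ∀ m {n} → 1 ≤ n → m ∣ m ^ n
m∣m^n m {suc n} _ = m∣m*n (m ^ n)

m*[n%o]%o≡m*n%o : ∀ m n o .{{_ : NonZero o}} → m * (n % o) % o ≡ m * n % o
m*[n%o]%o≡m*n%o m n o = begin
  m * (n % o) % o             ≡⟨ %-distribˡ-* m (n % o) o ⟩
  (m % o) * (n % o % o) % o   ≡⟨ cong (λ t → (m % o) * t % o) (m%n%n≡m%n n o) ⟩
  (m % o) * (n % o) % o       ≡⟨ %-distribˡ-* m n o ⟨
  m * n % o                   ∎
  where open ≡-Reasoning

module CyclicGroup (n : ℕ) .{{_ : NonZero n}} where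

  toℕ-mod : ∀ m → toℕ (m mod n) ≡ m % n
  toℕ-mod m = toℕ-fromℕ< (m%n<n m n)

  toℕ%n≡toℕ : (x : Fin n) → toℕ x % n ≡ toℕ x
  toℕ%n≡toℕ x = m<n⇒m%n≡m (toℕ<n x)

  ∣⇒∣mod : ∀ {g m} → g ∣ n → g ∣ m → g ∣ toℕ (m mod n)
  ∣⇒∣mod {g} {m} g∣n g∣m = subst (g ∣_) (sym (toℕ-mod m)) (%-presˡ-∣ g∣m g∣n)

  ∣mod⇒∣ : ∀ {g m} → g ∣ n → g ∣ toℕ (m mod n) → g ∣ m
  ∣mod⇒∣ {g} {m} g∣n g∣[m] = ∣n∣m%n⇒∣m g∣n (subst (g ∣_) (toℕ-mod m) g∣[m])

  ∈⟨⟩-refl : (x : Fin n) → x ∈⟨ x ⟩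
  ∈⟨⟩-refl x = 1 , trans (cong (_% n) (*-identityˡ (toℕ x))) (toℕ%n≡toℕ x)

  ∈⟨⟩-trans : {x y z : Fin n} → z ∈⟨ x ⟩ → x ∈⟨ y ⟩ → z ∈⟨ y ⟩
  ∈⟨⟩-trans {x} {y} {z} (k , k·x≡z) (l , l·y≡x) = k * l , (begin
    k * l * toℕ y % n       ≡⟨ cong (_% n) (*-assoc k l (toℕ y)) ⟩
    k * (l * toℕ y) % n     ≡⟨ m*[n%o]%o≡m*n%o k (l * toℕ y) n ⟨
    k * (l * toℕ y % n) % n ≡⟨ cong (λ t → k * t % n) l·y≡x ⟩
    k * toℕ x % n           ≡⟨ k·x≡z ⟩
    toℕ z                   ∎)
    where open ≡-Reasoning

  ∈⟨⟩⇒⊆⟨⟩ : {x y : Fin n} → x ∈⟨ y ⟩ → x ⊆⟨⟩ y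
  ∈⟨⟩⇒⊆⟨⟩ x∈⟨y⟩ z z∈⟨x⟩ = ∈⟨⟩-trans z∈⟨x⟩ x∈⟨y⟩

  *-mod-∈⟨⟩ : ∀ m (y : Fin n) → ((m * toℕ y) mod n) ∈⟨ y ⟩
  *-mod-∈⟨⟩ m y = m , sym (toℕ-mod (m * toℕ y))

  ∣⇒∈⟨mod⟩ : ∀ {m} {x : Fin n} → m ∣ toℕ x → x ∈⟨ m mod n ⟩
  ∣⇒∈⟨mod⟩ {m} {x} (divides k x≡k·m) = k , (begin
    k * toℕ (m mod n) % n ≡⟨ cong (λ t → k * t % n) (toℕ-mod m) ⟩
    k * (m % n) % n       ≡⟨ m*[n%o]%o≡m*n%o k m n ⟩
    k * m % n             ≡⟨ cong (_% n) x≡k·m ⟨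
    toℕ x % n             ≡⟨ toℕ%n≡toℕ x ⟩
    toℕ x                 ∎)
    where open ≡-Reasoning

  _Separates_from_ : ℕ → Fin n → Fin n → Set
  g Separates x from y = g ∣ n × g ∣ toℕ x × ¬ g ∣ toℕ y

  separates⇒≢ : ∀ {g x y} → g Separates x from y → x ≢ y
  separates⇒≢ (_ , g∣x , g∤y) refl = g∤y g∣x

  separates⇒⊈ : ∀ {g x y} → g Separates x from y → ¬ y ⊆⟨⟩ x
  separates⇒⊈ {g} {x} {y} (g∣n , g∣x , g∤y) y⊆x with y⊆x y (∈⟨⟩-refl y)
  ... | k , k·x≡y = g∤y (subst (g ∣_) k·x≡y (%-presˡ-∣ (∣n⇒∣m*n k g∣x) g∣n))

  adjacent-above : ∀ {g v x} → g Separates v from x → v ∈⟨ x ⟩ → Adj v x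
  adjacent-above g-sep v∈⟨x⟩ = separates⇒≢ g-sep , inj₁ (∈⟨⟩⇒⊆⟨⟩ v∈⟨x⟩)

  adjacent-below : ∀ {g v x} → g Separates x from v → x ∈⟨ v ⟩ → Adj v x
  adjacent-below g-sep x∈⟨v⟩ = ≢-sym (separates⇒≢ g-sep) , inj₂ (∈⟨⟩⇒⊆⟨⟩ x∈⟨v⟩)

  incomparable-neighbours⇒¬simplicial : ∀ {g h v x y} → Adj v x → Adj v y →
    g Separates x from y → h Separates y from x → ¬ Simplicial v
  incomparable-neighbours⇒¬simplicial {x = x} {y} v~x v~y g-sep h-sep simplicial
    with simplicial x y v~x v~y (separates⇒≢ g-sep)
  ... | _ , inj₁ x⊆y = separates⇒⊈ h-sep x⊆y
  ... | _ , inj₂ y⊆x = separates⇒⊈ g-sep y⊆x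

  prime-divisors⇒¬simplicial : ∀ {p q} → Prime p → Prime q → p ≢ q → p ∣ n → q ∣ n →
    (v : Fin n) → p ∣ toℕ v → q ∣ toℕ v → ¬ Simplicial v
  prime-divisors⇒¬simplicial {p} {q} pp qp p≢q p∣n q∣n v p∣v q∣v =
    incomparable-neighbours⇒¬simplicial
      (adjacent-above (q∣n , q∣v , q∤[p]) (∣⇒∈⟨mod⟩ p∣v))
      (adjacent-above (p∣n , p∣v , p∤[q]) (∣⇒∈⟨mod⟩ q∣v))
      (p∣n , ∣⇒∣mod p∣n ∣-refl , p∤[q])
      (q∣n , ∣⇒∣mod q∣n ∣-refl , q∤[p])
    where
    p∤[q] : ¬ p ∣ toℕ (q mod n)
    p∤[q] p∣[q] = prime∤prime pp qp p≢q (∣mod⇒∣ p∣n p∣[q])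
    q∤[p] : ¬ q ∣ toℕ (p mod n)
    q∤[p] q∣[p] = prime∤prime qp pp (≢-sym p≢q) (∣mod⇒∣ q∣n q∣[p])

  prime-non-divisors⇒¬simplicial : ∀ {p q} → Prime p → Prime q → p ≢ q → p ∣ n → q ∣ n →
    (v : Fin n) → ¬ p ∣ toℕ v → ¬ q ∣ toℕ v → ¬ Simplicial v
  prime-non-divisors⇒¬simplicial {p} {q} pp qp p≢q p∣n q∣n v p∤v q∤v =
    incomparable-neighbours⇒¬simplicial
      (adjacent-below (p∣n , p∣[pv] , p∤v) (*-mod-∈⟨⟩ p v))
      (adjacent-below (q∣n , q∣[qv] , q∤v) (*-mod-∈⟨⟩ q v))
      (p∣n , p∣[pv] , λ p∣[qv] → prime∤* pp (prime∤prime pp qp p≢q) p∤v (∣mod⇒∣ p∣n p∣[qv]))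
      (q∣n , q∣[qv] , λ q∣[pv] →
        prime∤* qp (prime∤prime qp pp (≢-sym p≢q)) q∤v (∣mod⇒∣ q∣n q∣[pv]))
    where
    p∣[pv] : p ∣ toℕ ((p * toℕ v) mod n)
    p∣[pv] = ∣⇒∣mod p∣n (m∣m*n (toℕ v))
    q∣[qv] : q ∣ toℕ ((q * toℕ v) mod n)
    q∣[qv] = ∣⇒∣mod q∣n (m∣m*n (toℕ v))

  three-prime-divisors⇒¬simplicial : ∀ {p q r} → Prime p → Prime q → Prime r →
    p ≢ q → p ≢ r → q ≢ r → p ∣ n → q ∣ n → r ∣ n → (v : Fin n) → ¬ Simplicial v
  three-prime-divisors⇒¬simplicial {p} {q} {r} pp qp rp p≢q p≢r q≢r p∣n q∣n r∣n v
    with p ∣? toℕ v | q ∣? toℕ v | r ∣? toℕ v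
  ... | yes p∣v | yes q∣v | _       = prime-divisors⇒¬simplicial pp qp p≢q p∣n q∣n v p∣v q∣v
  ... | yes p∣v | no _    | yes r∣v = prime-divisors⇒¬simplicial pp rp p≢r p∣n r∣n v p∣v r∣v
  ... | yes _   | no q∤v  | no r∤v  = prime-non-divisors⇒¬simplicial qp rp q≢r q∣n r∣n v q∤v r∤v
  ... | no _    | yes q∣v | yes r∣v = prime-divisors⇒¬simplicial qp rp q≢r q∣n r∣n v q∣v r∣v
  ... | no p∤v  | yes _   | no r∤v  = prime-non-divisors⇒¬simplicial pp rp p≢r p∣n r∣n v p∤v r∤v
  ... | no p∤v  | no q∤v  | _       = prime-non-divisors⇒¬simplicial pp qp p≢q p∣n q∣n v p∤v q∤v

base∣product-of-powers : ∀ {p a} (fs : List (ℕ × ℕ)) → (p , a) ∈ fs → 1 ≤ a →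
  p ∣ product (map (λ pa → proj₁ pa ^ proj₂ pa) fs)
base∣product-of-powers {p} fs pa∈fs 1≤a =
  ∣-trans (m∣m^n p 1≤a) (∈⇒∣product (∈-map⁺ (λ pa → proj₁ pa ^ proj₂ pa) pa∈fs))

theorem6 : (n : ℕ) .{{_ : NonZero n}} (fs : List (ℕ × ℕ)) →
    All (λ pa → Prime (proj₁ pa) × 1 ≤ proj₂ pa) fs →
    Unique (map proj₁ fs) →
    n ≡ product (map (λ pa → proj₁ pa ^ proj₂ pa) fs) →
    3 ≤ length fs →
    (v : Fin n) → ¬ Simplicial v
theorem6 n fs@((p , a) ∷ (q , b) ∷ (r , c) ∷ _)
  ((pp , 1≤a) ∷ (qp , 1≤b) ∷ (rp , 1≤c) ∷ _) ((p≢q ∷ p≢r ∷ _) ∷ (q≢r ∷ _) ∷ _) refl _ =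
  CyclicGroup.three-prime-divisors⇒¬simplicial n pp qp rp p≢q p≢r q≢r
    (base∣product-of-powers fs (here refl) 1≤a)
    (base∣product-of-powers fs (there (here refl)) 1≤b)
    (base∣product-of-powers fs (there (there (here refl))) 1≤c)
theorem6 n (_ ∷ _ ∷ []) _ _ _ (s≤s (s≤s ()))
theorem6 n (_ ∷ []) _ _ _ (s≤s ())
theorem6 n [] _ _ _ ()
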